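{- Let $\mathcal{F}$ be a family of subsets of $[n]$, and suppose $\lambda(\mathcal{F})=x+y$ where $x$ is a nonnegative integer and $y$ is a nonnegative real number. Then $$|\mathcal{F}|\le\Sigma(n,x)+y\binom{n}{\lceil\frac{n+x}{2}\rceil}.$$
   Context: $[n]=\{1,2,\dots,n\}$. The Lubell function of a family $\mathcal{F}$ of subsets of $[n]$ is $\lambda(\mathcal{F})=\sum_{F\in\mathcal{F}}\binom{n}{|F|}^{ -1}$. For integers $n,k$, $\Sigma(n,k)=\sum_{i=\lceil\frac{n-k}{2}\rceil}^{\lceil\frac{n+k}{2}\rceil-1}\binom{n}{i}$ denotes the sum of the $k$ largest binomial coefficients $\binom{n}{i}$. -}

module Defs where

open import Data.Nat using (ℕ; zero; suc; _+_; _∸_; _/_)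
open import Data.Nat.Combinatorics using (_C_)
open import Data.Integer using (+_)
open import Data.List using (List; []; _∷_; map; upTo)
open import Data.Nat.ListAction using (sum)
open import Data.Fin.Subset using (Subset; ∣_∣)
open import Data.Rational as ℚ using (ℚ; 0ℚ)

ℕ→ℚ : ℕ → ℚ
ℕ→ℚ m = ℚ._/_ (+ m) 1

-- 1/m as a rational (0 for m = 0; only used with nonzero binomial coefficients)
inv : ℕ → ℚ
inv zero = 0ℚ
inv (suc m) = ℚ._/_ (+ 1) (suc m)

⌈_/2⌉ : ℕ → ℕ
⌈ m /2⌉ = (m + 1) / 2

lubell : {n : ℕ} → List (Subset n) → ℚ
lubell {n} [] = 0ℚ
lubell {n} (S ∷ F) = inv (n C ∣ S ∣) ℚ.+ lubell F

-- Σ(n,k) = Σ_{i = ⌈(n-k)/2⌉}^{⌈(n+k)/2⌉ - 1} C(n,i).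
-- When k > n the lower index ⌈(n-k)/2⌉ is ≤ 0; truncating it to 0 (via ∸)
-- changes nothing since C(n,i) = 0 for i < 0.
Σnk : ℕ → ℕ → ℕ
Σnk n k = sum (map (λ j → n C (lo + j)) (upTo (⌈ n + k /2⌉ ∸ lo)))
  where lo = ⌈ n ∸ k /2⌉

module Submission where

-- Let f_i be the number of members of F of size i, so f_i ≤ C(n,i),
-- |F| = Σ_i f_i and λ(F) = Σ_i f_i / C(n,i).  Let L = ⌈(n-x)/2⌉ and
-- H = ⌈(n+x)/2⌉; the levels L ≤ i < H are the x central ones (when x ≤ n),
-- whose binomial coefficients C(n,i) are at least M, while every other level
-- has C(n,i) ≤ M (unimodality of binomial coefficients).  Level by level:
--   outside the window:  f_i       ≤ f_i·M/C(n,i)            (as C(n,i) ≤ M),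
--   inside the window:   f_i + M   ≤ f_i·M/C(n,i) + C(n,i)   (⇔ (C-f)(C-M) ≥ 0).
-- Summing over all levels gives |F| + x·M ≤ M·λ(F) + Σ(n,x), which is the claim
-- after subtracting x·M.  When x > n the window is all of [0,n] and M = 0.

open import Defs
open import Data.Nat as ℕ using (ℕ; zero; suc)
open import Data.Nat.Combinatorics using (_C_)
open import Data.List using (List; []; _∷_; length; map; applyUpTo)
open import Data.List.Relation.Unary.Unique.Propositional using (Unique)
open import Data.Fin.Subset using (Subset; ∣_∣)
open import Data.List.Relation.Unary.All using (All; []; _∷_)
open import Data.List.Relation.Unary.AllPairs using ([]; _∷_)
open import Data.Vec using ([]; _∷_)
open import Data.Bool using (Bool; true; false; if_then_else_)
open import Data.Fin.Subset.Properties using (∣p∣≤n)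
open import Data.Product using (_×_; _,_; proj₁; proj₂)
open import Function using (_∘_)
open import Relation.Nullary using (yes; no)
open import Relation.Binary.PropositionalEquality

module LevelCounts where
  open import Data.Nat using (_+_; _≤_; z≤n; s≤s; _≡ᵇ_)
  open import Data.Nat.Properties using (+-assoc; +-mono-≤; +-commutativeSemigroup)
  open import Algebra.Properties.CommutativeSemigroup +-commutativeSemigroup using (x∙yz≈y∙xz)
  open import Data.Nat.Combinatorics using (nCk+nC[k+1]≡[n+1]C[k+1])
  open import Data.Empty using (⊥-elim)

  δ : ℕ → ℕ → ℕ
  δ a b = if a ≡ᵇ b then 1 else 0

  count : ∀ {n} → ℕ → List (Subset n) → ℕ
  count i [] = 0
  count i (S ∷ F) = δ ∣ S ∣ i + count i F

  slice : ∀ {n} → Bool → List (Subset (suc n)) → List (Subset n)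
  slice b [] = []
  slice true  ((true  ∷ p) ∷ F) = p ∷ slice true F
  slice true  ((false ∷ p) ∷ F) = slice true F
  slice false ((true  ∷ p) ∷ F) = slice false F
  slice false ((false ∷ p) ∷ F) = p ∷ slice false F

  slice-avoids : ∀ {n} b {p : Subset n} F → All ((b ∷ p) ≢_) F → All (p ≢_) (slice b F)
  slice-avoids b     []                []       = []
  slice-avoids true  ((true  ∷ q) ∷ F) (ne ∷ r) = ne ∘ cong (true ∷_) ∷ slice-avoids true F r
  slice-avoids true  ((false ∷ q) ∷ F) (_  ∷ r) = slice-avoids true F r
  slice-avoids false ((true  ∷ q) ∷ F) (_  ∷ r) = slice-avoids false F r
  slice-avoids false ((false ∷ q) ∷ F) (ne ∷ r) = ne ∘ cong (false ∷_) ∷ slice-avoids false F r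

  slice-unique : ∀ {n} b (F : List (Subset (suc n))) → Unique F → Unique (slice b F)
  slice-unique b     []                []       = []
  slice-unique true  ((true  ∷ p) ∷ F) (ne ∷ u) = slice-avoids true F ne ∷ slice-unique true F u
  slice-unique true  ((false ∷ p) ∷ F) (_  ∷ u) = slice-unique true F u
  slice-unique false ((true  ∷ p) ∷ F) (_  ∷ u) = slice-unique false F u
  slice-unique false ((false ∷ p) ∷ F) (ne ∷ u) = slice-avoids false F ne ∷ slice-unique false F u

  -- a set of size i+1 either contains the first point (and has i further
  -- points) or avoids it (and has i+1 further points)
  count-suc : ∀ {n} i (F : List (Subset (suc n))) →
              count (suc i) F ≡ count i (slice true F) + count (suc i) (slice false F)
  count-suc i [] = refl
  count-suc i ((true ∷ p) ∷ F) =
    trans (cong (δ ∣ p ∣ i +_) (count-suc i F)) (sym (+-assoc (δ ∣ p ∣ i) _ _))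
  count-suc i ((false ∷ p) ∷ F) =
    trans (cong (δ ∣ p ∣ (suc i) +_) (count-suc i F)) 
      (x∙yz≈y∙xz (δ ∣ p ∣ (suc i)) (count i (slice true F)) (count (suc i) (slice false F)))

  -- the empty set avoids the first point
  count-zero : ∀ {n} (F : List (Subset (suc n))) → count 0 F ≡ count 0 (slice false F)
  count-zero [] = refl
  count-zero ((true  ∷ p) ∷ F) = count-zero F
  count-zero ((false ∷ p) ∷ F) = cong (δ ∣ p ∣ 0 +_) (count-zero F)

  count-bound : ∀ n i (F : List (Subset n)) → Unique F → count i F ≤ n C i
  count-bound zero    zero    []                  _                = z≤n
  count-bound zero    zero    ([] ∷ [])           _                = s≤s z≤n
  count-bound zero    zero    ([] ∷ [] ∷ F)       ((ne ∷ _) ∷ _)   = ⊥-elim (ne refl)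
  count-bound zero    (suc i) []                  _                = z≤n
  count-bound zero    (suc i) ([] ∷ F)            (_ ∷ u)          = count-bound zero (suc i) F u
  count-bound (suc n) zero    F                   u                =
    subst (_≤ 1) (sym (count-zero F)) (count-bound n zero (slice false F) (slice-unique false F u))
  count-bound (suc n) (suc i) F                   u                =
    subst₂ _≤_ (sym (count-suc i F)) (nCk+nC[k+1]≡[n+1]C[k+1] n i)
      (+-mono-≤ (count-bound n i (slice true F) (slice-unique true F u))
                (count-bound n (suc i) (slice false F) (slice-unique false F u)))

open LevelCounts using (δ; count; count-bound)

module Unimodality where
  open import Data.Nat using (_+_; _∸_; _≤_; z≤n; s≤s; _≤?_)
  open import Data.Nat.Properties
  open import Data.Nat.Combinatorics using (nCk+nC[k+1]≡[n+1]C[k+1]; nCk≡nC[n∸k]; k>n⇒nCk≡0)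

  C-mono-lower : ∀ n i j → i ≤ j → i + j ≤ n → n C i ≤ n C j
  C-mono-lower zero    zero    zero    _ _ = ≤-refl
  C-mono-lower (suc n) zero    zero    _ _ = ≤-refl
  C-mono-lower (suc n) zero    (suc j) _ (s≤s j≤n) =
    subst (1 ≤_) (nCk+nC[k+1]≡[n+1]C[k+1] n j)
      (≤-trans (C-mono-lower n 0 j z≤n j≤n) (m≤m+n (n C j) _))
  C-mono-lower (suc n) (suc i) (suc j) (s≤s i≤j) (s≤s i+1+j≤n) with i ≟ j
  ... | yes refl = ≤-refl
  ... | no i≢j =
    -- Pascal's rule on both sides; compare C(n,i) with C(n,j+1) and C(n,i+1) with C(n,j)
    subst₂ _≤_ (nCk+nC[k+1]≡[n+1]C[k+1] n i)
               (trans (+-comm (n C suc j) (n C j)) (nCk+nC[k+1]≡[n+1]C[k+1] n j))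
      (+-mono-≤ (C-mono-lower n i (suc j) (m≤n⇒m≤1+n i≤j) i+1+j≤n)
                (C-mono-lower n (suc i) j (≤∧≢⇒< i≤j i≢j) (subst (_≤ n) (+-suc i j) i+1+j≤n)))

  -- above the middle (j ≤ i and n ≤ i + j):  C(n,i) ≤ C(n,j), by the symmetry C(n,k) = C(n,n-k)
  C-antimono-upper : ∀ n i j → j ≤ i → n ≤ i + j → n C i ≤ n C j
  C-antimono-upper n i j j≤i n≤i+j with i ≤? n
  ... | no i≰n = subst (_≤ n C j) (sym (k>n⇒nCk≡0 (≰⇒> i≰n))) z≤n
  ... | yes i≤n =
    subst₂ _≤_ (sym (nCk≡nC[n∸k] i≤n)) (sym (nCk≡nC[n∸k] (≤-trans j≤i i≤n)))
      (C-mono-lower n (n ∸ i) (n ∸ j) (∸-monoʳ-≤ n j≤i) n-i+n-j≤n)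
    where
    n-i+n-j≤n : (n ∸ i) + (n ∸ j) ≤ n
    n-i+n-j≤n = subst ((n ∸ i) + (n ∸ j) ≤_) (m∸n+n≡m i≤n)
      (+-monoʳ-≤ (n ∸ i) (m≤n+o⇒m∸n≤o n j (subst (n ≤_) (+-comm i j) n≤i+j)))

open Unimodality using (C-mono-lower; C-antimono-upper)

module CentralWindow where
  open import Data.Nat using (_+_; _∸_; _*_; _/_; _%_; _≤_; _<_; z≤n; _≤?_)
  open import Data.Nat.Properties
  open import Data.Nat.DivMod using (m≡m%n+[m/n]*n; m%n<n; +-distrib-/-∣ˡ; m*n/n≡m; /-monoˡ-≤)
  open import Data.Nat.Divisibility using (n∣m*n)
  open import Data.Nat.Combinatorics using (k>n⇒nCk≡0)
  open import Data.Nat.Tactic.RingSolver using (solve-∀)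
  open import Data.Empty using (⊥-elim)
  open ≤-Reasoning

  lower upper peak width : ℕ → ℕ → ℕ
  lower n x = ⌈ n ∸ x /2⌉
  upper n x = ⌈ n + x /2⌉
  peak n x = n C upper n x
  width n x = upper n x ∸ lower n x

  record Window (n x : ℕ) : Set where
    field
      lower≤upper  : lower n x ≤ upper n x
      inside-large : ∀ j → j < width n x → peak n x ≤ n C (lower n x + j)
      below-small  : ∀ i → i < lower n x → n C i ≤ peak n x
      above-small  : ∀ i → upper n x ≤ i → n C i ≤ peak n x
      width-covers : x * peak n x ≤ width n x * peak n x

  ceil-half-bounds : ∀ d → d ≤ ⌈ d /2⌉ * 2 × ⌈ d /2⌉ * 2 ≤ suc d
  ceil-half-bounds d = ≤-pred lo , hi
    where
    division : suc d ≡ (d + 1) % 2 + ⌈ d /2⌉ * 2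
    division = trans (+-comm 1 d) (m≡m%n+[m/n]*n (d + 1) 2)
    hi : ⌈ d /2⌉ * 2 ≤ suc d
    hi = subst (⌈ d /2⌉ * 2 ≤_) (sym division) (m≤n+m _ _)
    lo : suc d ≤ suc (⌈ d /2⌉ * 2)
    lo = subst (_≤ suc (⌈ d /2⌉ * 2)) (sym division) (+-monoˡ-≤ _ (≤-pred (m%n<n (d + 1) 2)))

  module Narrow {n x : ℕ} (x≤n : x ≤ n) where
    private
      d = n ∸ x
      L = lower n x
      H = upper n x

      n≡d+x : n ≡ d + x
      n≡d+x = sym (m∸n+n≡m x≤n)

      double : ∀ d x → d + x + x + 1 ≡ x * 2 + (d + 1)
      double = solve-∀

    upper≡x+lower : H ≡ x + L
    upper≡x+lower = begin-equality
      (n + x + 1) / 2           ≡⟨ cong (λ m → (m + x + 1) / 2) n≡d+x ⟩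
      (d + x + x + 1) / 2       ≡⟨ cong (_/ 2) (double d x) ⟩
      (x * 2 + (d + 1)) / 2     ≡⟨ +-distrib-/-∣ˡ (d + 1) (n∣m*n x) ⟩
      x * 2 / 2 + (d + 1) / 2   ≡⟨ cong (_+ L) (m*n/n≡m x 2) ⟩
      x + L                     ∎

    private
      L+H≡2L+x : L + H ≡ L * 2 + x
      L+H≡2L+x = trans (cong (L +_) upper≡x+lower) (lemma L x)
        where lemma : ∀ L x → L + (x + L) ≡ L * 2 + x
              lemma = solve-∀

    n≤L+H : n ≤ L + H
    n≤L+H = begin
      n          ≡⟨ n≡d+x ⟩
      d + x      ≤⟨ +-monoˡ-≤ x (proj₁ (ceil-half-bounds d)) ⟩
      L * 2 + x  ≡⟨ L+H≡2L+x ⟨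
      L + H      ∎

    L+H≤1+n : L + H ≤ suc n
    L+H≤1+n = begin
      L + H      ≡⟨ L+H≡2L+x ⟩
      L * 2 + x  ≤⟨ +-monoˡ-≤ x (proj₂ (ceil-half-bounds d)) ⟩
      suc d + x  ≡⟨ cong suc n≡d+x ⟨
      suc n      ∎

    window : Window n x
    window = record
      { lower≤upper  = L≤H
      ; inside-large = inside-large
      ; below-small  = below-small
      ; above-small  = above-small
      ; width-covers = ≤-reflexive (cong (_* peak n x) (sym width≡x))
      }
      where
      L≤H : L ≤ H
      L≤H = subst (L ≤_) (sym upper≡x+lower) (m≤n+m L x)
      width≡x : width n x ≡ x
      width≡x = trans (cong (_∸ L) upper≡x+lower) (m+n∸n≡m x L)

      inside-large : ∀ j → j < width n x → peak n x ≤ n C (L + j)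
      inside-large j j<w = C-antimono-upper n H (L + j) L+j≤H (begin
        n            ≤⟨ n≤L+H ⟩
        L + H        ≡⟨ +-comm L H ⟩
        H + L        ≤⟨ +-monoʳ-≤ H (m≤m+n L j) ⟩
        H + (L + j)  ∎)
        where
        L+j≤H : L + j ≤ H
        L+j≤H = subst (L + j ≤_) (trans (+-comm L x) (sym upper≡x+lower))
                  (+-monoʳ-≤ L (<⇒≤ (subst (j <_) width≡x j<w)))

      below-small : ∀ i → i < L → n C i ≤ peak n x
      below-small i i<L = C-mono-lower n i H (≤-trans (<⇒≤ i<L) L≤H)
        (≤-pred (≤-trans (+-monoˡ-≤ H i<L) L+H≤1+n))

      above-small : ∀ i → H ≤ i → n C i ≤ peak n x
      above-small i H≤i = C-antimono-upper n i H H≤i (begin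
        n      ≤⟨ n≤L+H ⟩
        L + H  ≤⟨ +-monoˡ-≤ H (≤-trans L≤H H≤i) ⟩
        i + H  ∎)

  module Wide {n x : ℕ} (n<x : n < x) where
    private
      L = lower n x
      H = upper n x

    lower≡0 : L ≡ 0
    lower≡0 = cong ⌈_/2⌉ (m≤n⇒m∸n≡0 (<⇒≤ n<x))

    n<upper : n < H
    n<upper = begin
      suc n                ≡⟨ m*n/n≡m (suc n) 2 ⟨
      suc n * 2 / 2        ≡⟨ cong (_/ 2) (lemma n) ⟩
      (n + suc n + 1) / 2  ≤⟨ /-monoˡ-≤ 2 (+-monoˡ-≤ 1 (+-monoʳ-≤ n n<x)) ⟩
      (n + x + 1) / 2      ∎
      where lemma : ∀ n → suc n * 2 ≡ n + suc n + 1
            lemma = solve-∀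

    vanishes : ∀ i → H ≤ i → n C i ≡ 0
    vanishes i H≤i = k>n⇒nCk≡0 (<-≤-trans n<upper H≤i)

    peak≡0 : peak n x ≡ 0
    peak≡0 = vanishes H ≤-refl

    window : Window n x
    window = record
      { lower≤upper  = subst (_≤ H) (sym lower≡0) z≤n
      ; inside-large = λ j _ → subst (_≤ n C (L + j)) (sym peak≡0) z≤n
      ; below-small  = λ i i<L → ⊥-elim (n≮0 (subst (i <_) lower≡0 i<L))
      ; above-small  = λ i H≤i → subst (_≤ peak n x) (sym (vanishes i H≤i)) z≤n
      ; width-covers = subst (λ p → x * p ≤ width n x * p) (sym peak≡0)
                         (≤-reflexive (trans (*-zeroʳ x) (sym (*-zeroʳ (width n x)))))
      }

  central-window : ∀ n x → Window n x
  central-window n x with x ≤? n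
  ... | yes x≤n = Narrow.window x≤n
  ... | no  x≰n = Wide.window (≰⇒> x≰n)

open CentralWindow using (lower; upper; peak; width; Window; central-window)

-- For f, M ≤ c:  (f + M)·c ≤ f·M + c·c,  the difference being (c - f)(c - M).
module ProductGap where
  open import Data.Nat using (_+_; _*_; _∸_; _≤_)
  open import Data.Nat.Properties using (m+[n∸m]≡n; m≤m+n)
  open import Data.Nat.Tactic.RingSolver using (solve-∀)
  open ≡-Reasoning

  gap-identity : ∀ f M p q {c} → f + p ≡ c → M + q ≡ c → f * M + c * c ≡ (f + M) * c + p * q
  gap-identity f M p q refl M+q≡c = begin
    f * M + (f + p) * (f + p)              ≡⟨ cong (λ z → f * M + (f + p) * z) (sym M+q≡c) ⟩
    f * M + (f + p) * (M + q)              ≡⟨ expand₁ f M p q ⟩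
    f * (M + q) + M * (f + p) + p * q      ≡⟨ cong (λ z → f * z + M * (f + p) + p * q) M+q≡c ⟩
    f * (f + p) + M * (f + p) + p * q      ≡⟨ expand₂ f M p q ⟩
    (f + M) * (f + p) + p * q              ∎
    where
    expand₁ : ∀ f M p q → f * M + (f + p) * (M + q) ≡ f * (M + q) + M * (f + p) + p * q
    expand₁ = solve-∀
    expand₂ : ∀ f M p q → f * (f + p) + M * (f + p) + p * q ≡ (f + M) * (f + p) + p * q
    expand₂ = solve-∀

  gap-inequality : ∀ {f M c} → f ≤ c → M ≤ c → (f + M) * c ≤ f * M + c * c
  gap-inequality {f} {M} {c} f≤c M≤c =
    subst ((f + M) * c ≤_)
      (sym (gap-identity f M (c ∸ f) (c ∸ M) (m+[n∸m]≡n f≤c) (m+[n∸m]≡n M≤c)))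
      (m≤m+n _ _)

open ProductGap using (gap-inequality)

open import Data.Rational using (_≤_; _+_; _-_; _*_)
open import Data.Rational as ℚ using (ℚ; mkℚ; 0ℚ; 1ℚ; toℚᵘ; -_)
import Data.Rational.Properties as ℚP
open import Data.Rational.Unnormalised as ℚᵘ using (mkℚᵘ; *≡*; *≤*)
import Data.Rational.Unnormalised.Properties as ℚᵘP
import Data.Integer as ℤ
import Data.Integer.Properties as ℤP
import Data.Nat.Properties as ℕP
open import Data.Nat.Coprimality using (1-coprimeTo) renaming (sym to coprime-sym)
open import Data.Nat.ListAction using (sum)
open import Data.Rational.Solver using (module +-*-Solver)
open +-*-Solver using (solve; con; _:+_; _:*_; _:-_; _:=_)
open import Algebra.Bundles using (CommutativeMonoid)
open import Algebra.Properties.CommutativeSemigroup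
  (CommutativeMonoid.commutativeSemigroup ℚP.+-0-commutativeMonoid)
  using () renaming (interchange to +-interchange)

toℚᵘ-ℕ→ℚ : ∀ m → toℚᵘ (ℕ→ℚ m) ≡ mkℚᵘ (ℤ.+ m) 0
toℚᵘ-ℕ→ℚ m rewrite ℚP.normalize-coprime {m} {0} (coprime-sym (1-coprimeTo m)) = refl

integral-≃ : ∀ {i j} → i ≡ j → mkℚᵘ i 0 ℚᵘ.≃ mkℚᵘ j 0
integral-≃ i≡j = *≡* (cong (ℤ._* ℤ.+ 1) i≡j)

ℕ→ℚ-+ : ∀ a b → ℕ→ℚ (a ℕ.+ b) ≡ ℕ→ℚ a + ℕ→ℚ b
ℕ→ℚ-+ a b = ℚP.toℚᵘ-injective (begin
  toℚᵘ (ℕ→ℚ (a ℕ.+ b))            ≡⟨ toℚᵘ-ℕ→ℚ (a ℕ.+ b) ⟩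
  mkℚᵘ (ℤ.+ (a ℕ.+ b)) 0             ≈⟨ integral-≃ (trans (ℤP.pos-+ a b)
                                        (sym (cong₂ ℤ._+_ (ℤP.*-identityʳ (ℤ.+ a)) (ℤP.*-identityʳ (ℤ.+ b))))) ⟩
  mkℚᵘ (ℤ.+ a) 0 ℚᵘ.+ mkℚᵘ (ℤ.+ b) 0   ≡⟨ cong₂ ℚᵘ._+_ (toℚᵘ-ℕ→ℚ a) (toℚᵘ-ℕ→ℚ b) ⟨
  toℚᵘ (ℕ→ℚ a) ℚᵘ.+ toℚᵘ (ℕ→ℚ b)  ≈⟨ ℚP.toℚᵘ-homo-+ (ℕ→ℚ a) (ℕ→ℚ b) ⟨
  toℚᵘ (ℕ→ℚ a + ℕ→ℚ b)            ∎)
  where open ℚᵘP.≃-Reasoning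

ℕ→ℚ-* : ∀ a b → ℕ→ℚ (a ℕ.* b) ≡ ℕ→ℚ a * ℕ→ℚ b
ℕ→ℚ-* a b = ℚP.toℚᵘ-injective (begin
  toℚᵘ (ℕ→ℚ (a ℕ.* b))            ≡⟨ toℚᵘ-ℕ→ℚ (a ℕ.* b) ⟩
  mkℚᵘ (ℤ.+ (a ℕ.* b)) 0             ≈⟨ integral-≃ (ℤP.pos-* a b) ⟩
  mkℚᵘ (ℤ.+ a) 0 ℚᵘ.* mkℚᵘ (ℤ.+ b) 0   ≡⟨ cong₂ ℚᵘ._*_ (toℚᵘ-ℕ→ℚ a) (toℚᵘ-ℕ→ℚ b) ⟨
  toℚᵘ (ℕ→ℚ a) ℚᵘ.* toℚᵘ (ℕ→ℚ b)  ≈⟨ ℚP.toℚᵘ-homo-* (ℕ→ℚ a) (ℕ→ℚ b) ⟨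
  toℚᵘ (ℕ→ℚ a * ℕ→ℚ b)            ∎)
  where open ℚᵘP.≃-Reasoning

ℕ→ℚ-mono-≤ : ∀ {a b} → a ℕ.≤ b → ℕ→ℚ a ≤ ℕ→ℚ b
ℕ→ℚ-mono-≤ {a} {b} a≤b = ℚP.toℚᵘ-cancel-≤
  (subst₂ ℚᵘ._≤_ (sym (toℚᵘ-ℕ→ℚ a)) (sym (toℚᵘ-ℕ→ℚ b)) (*≤* (ℤP.*-monoʳ-≤-nonNeg (ℤ.+ 1) (ℤ.+≤+ a≤b))))

instance
  ℕ→ℚ-positive : ∀ {m} → ℚ.Positive (ℕ→ℚ (suc m))
  ℕ→ℚ-positive {m} = ℚP.normalize-pos (suc m) 1

inv-inverse : ∀ m → inv (suc m) * ℕ→ℚ (suc m) ≡ 1ℚ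
inv-inverse m
  rewrite ℚP.normalize-coprime {1} {m} (1-coprimeTo (suc m))
        | ℚP.normalize-coprime {suc m} {0} (coprime-sym (1-coprimeTo (suc m)))
  = ℚP.*-inverseˡ (mkℚ (ℤ.+ suc m) 0 (coprime-sym (1-coprimeTo (suc m))))

∑< : ℕ → (ℕ → ℚ) → ℚ
∑< zero    g = 0ℚ
∑< (suc k) g = g 0 + ∑< k (g ∘ suc)

∑<-cong : ∀ k {g h : ℕ → ℚ} → (∀ i → g i ≡ h i) → ∑< k g ≡ ∑< k h
∑<-cong zero    g≗h = refl
∑<-cong (suc k) g≗h = cong₂ _+_ (g≗h 0) (∑<-cong k (g≗h ∘ suc))

∑<-mono-≤ : ∀ k {g h : ℕ → ℚ} → (∀ i → i ℕ.< k → g i ≤ h i) → ∑< k g ≤ ∑< k h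
∑<-mono-≤ zero    g≤h = ℚP.≤-refl
∑<-mono-≤ (suc k) g≤h = ℚP.+-mono-≤ (g≤h 0 (ℕ.s≤s ℕ.z≤n)) (∑<-mono-≤ k (λ i i<k → g≤h (suc i) (ℕ.s≤s i<k)))

∑<-split : ∀ a b (g : ℕ → ℚ) → ∑< (a ℕ.+ b) g ≡ ∑< a g + ∑< b (λ j → g (a ℕ.+ j))
∑<-split zero    b g = sym (ℚP.+-identityˡ _)
∑<-split (suc a) b g = trans (cong (g 0 +_) (∑<-split a b (g ∘ suc))) (sym (ℚP.+-assoc (g 0) _ _))

∑<-+ : ∀ k (g h : ℕ → ℚ) → ∑< k (λ i → g i + h i) ≡ ∑< k g + ∑< k h
∑<-+ zero    g h = sym (ℚP.+-identityˡ 0ℚ)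
∑<-+ (suc k) g h = trans (cong (g 0 + h 0 +_) (∑<-+ k (g ∘ suc) (h ∘ suc)))
                         (+-interchange (g 0) (h 0) (∑< k (g ∘ suc)) (∑< k (h ∘ suc)))

∑<-const : ∀ k q → ∑< k (λ _ → q) ≡ ℕ→ℚ k * q
∑<-const zero    q = sym (ℚP.*-zeroˡ q)
∑<-const (suc k) q = begin
  q + ∑< k (λ _ → q)      ≡⟨ cong (q +_) (∑<-const k q) ⟩
  q + ℕ→ℚ k * q           ≡⟨ solve 2 (λ k q → q :+ k :* q := (con 1ℚ :+ k) :* q) refl (ℕ→ℚ k) q ⟩
  (1ℚ + ℕ→ℚ k) * q        ≡⟨ cong (_* q) (ℕ→ℚ-+ 1 k) ⟨
  ℕ→ℚ (suc k) * q         ∎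
  where open ≡-Reasoning

∑<-indicator : ∀ k s (g : ℕ → ℚ) → s ℕ.< k → ∑< k (λ i → ℕ→ℚ (δ s i) * g i) ≡ g s
∑<-indicator (suc k) zero g _ = begin
  1ℚ * g 0 + ∑< k (λ i → 0ℚ * g (suc i))  ≡⟨ cong₂ _+_ (ℚP.*-identityˡ (g 0)) (∑<-cong k (λ i → ℚP.*-zeroˡ (g (suc i)))) ⟩
  g 0 + ∑< k (λ _ → 0ℚ)                   ≡⟨ cong (g 0 +_) (trans (∑<-const k 0ℚ) (ℚP.*-zeroʳ (ℕ→ℚ k))) ⟩
  g 0 + 0ℚ                                ≡⟨ ℚP.+-identityʳ (g 0) ⟩
  g 0                                     ∎
  where open ≡-Reasoning
∑<-indicator (suc k) (suc s) g (ℕ.s≤s s<k) =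
  trans (cong₂ _+_ (ℚP.*-zeroˡ (g 0)) (∑<-indicator k s (g ∘ suc) s<k)) (ℚP.+-identityˡ (g (suc s)))

∑<-ℕ : ∀ k (g f : ℕ → ℕ) → ℕ→ℚ (sum (map g (applyUpTo f k))) ≡ ∑< k (λ i → ℕ→ℚ (g (f i)))
∑<-ℕ zero    g f = refl
∑<-ℕ (suc k) g f = trans (ℕ→ℚ-+ (g (f 0)) _) (cong (ℕ→ℚ (g (f 0)) +_) (∑<-ℕ k g (f ∘ suc)))

divide-≤ : ∀ c-1 A B E → A ℕ.* suc c-1 ℕ.≤ B ℕ.+ E ℕ.* suc c-1 →
           ℕ→ℚ A ≤ ℕ→ℚ B * inv (suc c-1) + ℕ→ℚ E
divide-≤ c-1 A B E Ac≤B+Ec = ℚP.*-cancelʳ-≤-pos c {{ℕ→ℚ-positive {c-1}}} (begin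
  ℕ→ℚ A * c                          ≡⟨ ℕ→ℚ-* A (suc c-1) ⟨
  ℕ→ℚ (A ℕ.* suc c-1)                ≤⟨ ℕ→ℚ-mono-≤ Ac≤B+Ec ⟩
  ℕ→ℚ (B ℕ.+ E ℕ.* suc c-1)          ≡⟨ trans (ℕ→ℚ-+ B _) (cong (ℕ→ℚ B +_) (ℕ→ℚ-* E (suc c-1))) ⟩
  ℕ→ℚ B + ℕ→ℚ E * c                  ≡⟨ cong (λ z → z + ℕ→ℚ E * c) (ℚP.*-identityʳ (ℕ→ℚ B)) ⟨
  ℕ→ℚ B * 1ℚ + ℕ→ℚ E * c             ≡⟨ cong (λ z → ℕ→ℚ B * z + ℕ→ℚ E * c) (inv-inverse c-1) ⟨
  ℕ→ℚ B * (i * c) + ℕ→ℚ E * c        ≡⟨ solve 4 (λ b i e c → b :* (i :* c) :+ e :* c := (b :* i :+ e) :* c)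
                                            refl (ℕ→ℚ B) i (ℕ→ℚ E) c ⟩
  (ℕ→ℚ B * i + ℕ→ℚ E) * c            ∎)
  where
  c = ℕ→ℚ (suc c-1)
  i = inv (suc c-1)
  open ℚP.≤-Reasoning

outer-level : ∀ {f c M} → f ℕ.≤ c → c ℕ.≤ M → ℕ→ℚ f ≤ ℕ→ℚ f * (ℕ→ℚ M * inv c)
outer-level {f} {zero} {M} f≤0 _ rewrite ℕP.n≤0⇒n≡0 f≤0 = ℚP.≤-reflexive (sym (ℚP.*-zeroˡ (ℕ→ℚ M * 0ℚ)))
outer-level {f} {suc c-1} {M} _ c≤M =
  subst (ℕ→ℚ f ≤_) fM/c
    (divide-≤ c-1 f (f ℕ.* M) 0 (subst (f ℕ.* suc c-1 ℕ.≤_) (sym (ℕP.+-identityʳ (f ℕ.* M))) (ℕP.*-monoʳ-≤ f c≤M)))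
  where
  fM/c : ℕ→ℚ (f ℕ.* M) * inv (suc c-1) + 0ℚ ≡ ℕ→ℚ f * (ℕ→ℚ M * inv (suc c-1))
  fM/c = trans (ℚP.+-identityʳ _)
           (trans (cong (_* inv (suc c-1)) (ℕ→ℚ-* f M)) (ℚP.*-assoc (ℕ→ℚ f) (ℕ→ℚ M) (inv (suc c-1))))

middle-level : ∀ {f c M} → f ℕ.≤ c → M ℕ.≤ c →
               ℕ→ℚ f + ℕ→ℚ M ≤ ℕ→ℚ f * (ℕ→ℚ M * inv c) + ℕ→ℚ c
middle-level {f} {zero} {M} f≤0 M≤0 rewrite ℕP.n≤0⇒n≡0 f≤0 | ℕP.n≤0⇒n≡0 M≤0 = ℚP.≤-refl
middle-level {f} {suc c-1} {M} f≤c M≤c =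
  subst₂ _≤_ (ℕ→ℚ-+ f M) fM/c+c (divide-≤ c-1 (f ℕ.+ M) (f ℕ.* M) (suc c-1) (gap-inequality f≤c M≤c))
  where
  fM/c+c : ℕ→ℚ (f ℕ.* M) * inv (suc c-1) + ℕ→ℚ (suc c-1)
         ≡ ℕ→ℚ f * (ℕ→ℚ M * inv (suc c-1)) + ℕ→ℚ (suc c-1)
  fM/c+c = cong (_+ ℕ→ℚ (suc c-1))
             (trans (cong (_* inv (suc c-1)) (ℕ→ℚ-* f M)) (ℚP.*-assoc (ℕ→ℚ f) (ℕ→ℚ M) (inv (suc c-1))))

three-block-bound : ∀ L D R (m : ℚ) (g h c : ℕ → ℚ) →
  (∀ i → i ℕ.< L → g i ≤ h i) →
  (∀ j → j ℕ.< D → g (L ℕ.+ j) + m ≤ h (L ℕ.+ j) + c j) →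
  (∀ j → j ℕ.< R → g (L ℕ.+ D ℕ.+ j) ≤ h (L ℕ.+ D ℕ.+ j)) →
  ∑< (L ℕ.+ D ℕ.+ R) g + ℕ→ℚ D * m ≤ ∑< (L ℕ.+ D ℕ.+ R) h + ∑< D c
three-block-bound L D R m g h c lower middle upper = begin
  ∑< (L ℕ.+ D ℕ.+ R) g + ℕ→ℚ D * m       ≡⟨ cong (_+ ℕ→ℚ D * m) (blocks g) ⟩
  (∑ₗ g + ∑ₘ g) + ∑ᵣ g + ℕ→ℚ D * m      ≡⟨ solve 4 (λ a b e d → (a :+ b) :+ e :+ d := (a :+ (b :+ d)) :+ e)
                                            refl (∑ₗ g) (∑ₘ g) (∑ᵣ g) (ℕ→ℚ D * m) ⟩
  (∑ₗ g + (∑ₘ g + ℕ→ℚ D * m)) + ∑ᵣ g    ≤⟨ ℚP.+-mono-≤ (ℚP.+-mono-≤ (∑<-mono-≤ L lower) middle-block)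
                                                         (∑<-mono-≤ R upper) ⟩
  (∑ₗ h + (∑ₘ h + ∑< D c)) + ∑ᵣ h       ≡⟨ solve 4 (λ a b e d → (a :+ (b :+ d)) :+ e := (a :+ b) :+ e :+ d)
                                            refl (∑ₗ h) (∑ₘ h) (∑ᵣ h) (∑< D c) ⟩
  (∑ₗ h + ∑ₘ h) + ∑ᵣ h + ∑< D c         ≡⟨ cong (_+ ∑< D c) (blocks h) ⟨
  ∑< (L ℕ.+ D ℕ.+ R) h + ∑< D c         ∎
  where
  open ℚP.≤-Reasoning
  ∑ₗ ∑ₘ ∑ᵣ : (ℕ → ℚ) → ℚ
  ∑ₗ k = ∑< L k
  ∑ₘ k = ∑< D (λ j → k (L ℕ.+ j))
  ∑ᵣ k = ∑< R (λ j → k (L ℕ.+ D ℕ.+ j))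

  blocks : ∀ k → ∑< (L ℕ.+ D ℕ.+ R) k ≡ (∑ₗ k + ∑ₘ k) + ∑ᵣ k
  blocks k = trans (∑<-split (L ℕ.+ D) R k) (cong (_+ ∑ᵣ k) (∑<-split L D k))

  middle-block : ∑ₘ g + ℕ→ℚ D * m ≤ ∑ₘ h + ∑< D c
  middle-block = subst₂ _≤_
    (trans (∑<-+ D _ _) (cong (∑ₘ g +_) (∑<-const D m)))
    (∑<-+ D _ _)
    (∑<-mono-≤ D middle)

sizeSum : ∀ {n} → List (Subset n) → (ℕ → ℚ) → ℚ
sizeSum []      g = 0ℚ
sizeSum (S ∷ F) g = g ∣ S ∣ + sizeSum F g

sizeSum-by-level : ∀ {n} K → n ℕ.< K → (F : List (Subset n)) (g : ℕ → ℚ) →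
                   sizeSum F g ≡ ∑< K (λ i → ℕ→ℚ (count i F) * g i)
sizeSum-by-level K n<K []      g = sym (trans (∑<-cong K (λ i → ℚP.*-zeroˡ (g i)))
                                               (trans (∑<-const K 0ℚ) (ℚP.*-zeroʳ (ℕ→ℚ K))))
sizeSum-by-level K n<K (S ∷ F) g = begin
  g ∣ S ∣ + sizeSum F g
    ≡⟨ cong₂ _+_ (sym (∑<-indicator K ∣ S ∣ g (ℕP.≤-<-trans (∣p∣≤n S) n<K))) (sizeSum-by-level K n<K F g) ⟩
  ∑< K (λ i → ℕ→ℚ (δ ∣ S ∣ i) * g i) + ∑< K (λ i → ℕ→ℚ (count i F) * g i)
    ≡⟨ ∑<-+ K _ _ ⟨
  ∑< K (λ i → ℕ→ℚ (δ ∣ S ∣ i) * g i + ℕ→ℚ (count i F) * g i)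
    ≡⟨ ∑<-cong K (λ i → trans (sym (ℚP.*-distribʳ-+ (g i) (ℕ→ℚ (δ ∣ S ∣ i)) _))
                              (cong (_* g i) (sym (ℕ→ℚ-+ (δ ∣ S ∣ i) (count i F))))) ⟩
  ∑< K (λ i → ℕ→ℚ (count i (S ∷ F)) * g i)
    ∎
  where open ≡-Reasoning

length-by-level : ∀ {n} K → n ℕ.< K → (F : List (Subset n)) →
                  ℕ→ℚ (length F) ≡ ∑< K (λ i → ℕ→ℚ (count i F))
length-by-level K n<K F =
  trans (length-as-sizeSum F)
    (trans (sizeSum-by-level K n<K F (λ _ → 1ℚ)) (∑<-cong K (λ i → ℚP.*-identityʳ _)))
  where
  length-as-sizeSum : ∀ {n} (F : List (Subset n)) → ℕ→ℚ (length F) ≡ sizeSum F (λ _ → 1ℚ)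
  length-as-sizeSum []      = refl
  length-as-sizeSum (S ∷ F) = trans (ℕ→ℚ-+ 1 (length F)) (cong (1ℚ +_) (length-as-sizeSum F))

lubell-by-level : ∀ {n} K → n ℕ.< K → (F : List (Subset n)) (q : ℚ) →
                  q * lubell F ≡ ∑< K (λ i → ℕ→ℚ (count i F) * (q * inv (n C i)))
lubell-by-level K n<K F q = trans (scaled-lubell F) (sizeSum-by-level K n<K F _)
  where
  scaled-lubell : ∀ {n} (F : List (Subset n)) → q * lubell F ≡ sizeSum F (λ i → q * inv (n C i))
  scaled-lubell         []      = ℚP.*-zeroʳ q
  scaled-lubell {n} (S ∷ F) =
    trans (ℚP.*-distribˡ-+ q (inv (n C ∣ S ∣)) (lubell F)) (cong (q * inv (n C ∣ S ∣) +_) (scaled-lubell F))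

Σnk-window : ∀ n x → ℕ→ℚ (Σnk n x) ≡ ∑< (width n x) (λ j → ℕ→ℚ (n C (lower n x ℕ.+ j)))
Σnk-window n x = ∑<-ℕ (width n x) (λ j → n C (lower n x ℕ.+ j)) (λ i → i)

window-inequality : ∀ n x (F : List (Subset n)) → Unique F →
  ℕ→ℚ (length F) + ℕ→ℚ (width n x) * ℕ→ℚ (peak n x) ≤ ℕ→ℚ (peak n x) * lubell F + ℕ→ℚ (Σnk n x)
window-inequality n x F u = begin
  ℕ→ℚ (length F) + ℕ→ℚ D * M    ≡⟨ cong (_+ ℕ→ℚ D * M) (length-by-level K n<K F) ⟩
  ∑< K f + ℕ→ℚ D * M            ≤⟨ three-block-bound L D (suc n) M f h c below inside above ⟩
  ∑< K h + ∑< D c               ≡⟨ cong₂ _+_ (lubell-by-level K n<K F M) (Σnk-window n x) ⟨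
  M * lubell F + ℕ→ℚ (Σnk n x)  ∎
  where
  open ℚP.≤-Reasoning
  open Window (central-window n x)
  L = lower n x
  D = width n x
  M = ℕ→ℚ (peak n x)
  K = L ℕ.+ D ℕ.+ suc n
  n<K : n ℕ.< K
  n<K = ℕP.m≤n+m (suc n) (L ℕ.+ D)

  f h : ℕ → ℚ
  f i = ℕ→ℚ (count i F)
  h i = f i * (M * inv (n C i))
  c : ℕ → ℚ
  c j = ℕ→ℚ (n C (L ℕ.+ j))

  below : ∀ i → i ℕ.< L → f i ≤ h i
  below i i<L = outer-level (count-bound n i F u) (below-small i i<L)

  inside : ∀ j → j ℕ.< D → f (L ℕ.+ j) + M ≤ h (L ℕ.+ j) + c j
  inside j j<D = middle-level (count-bound n (L ℕ.+ j) F u) (inside-large j j<D)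

  above : ∀ j → j ℕ.< suc n → f (L ℕ.+ D ℕ.+ j) ≤ h (L ℕ.+ D ℕ.+ j)
  above j _ = outer-level (count-bound n (L ℕ.+ D ℕ.+ j) F u) (above-small (L ℕ.+ D ℕ.+ j) upper≤)
    where
    -- the third block starts at L + (H - L) = H
    upper≤ : upper n x ℕ.≤ L ℕ.+ D ℕ.+ j
    upper≤ = subst (ℕ._≤ L ℕ.+ D ℕ.+ j) (ℕP.m+[n∸m]≡n lower≤upper) (ℕP.m≤m+n (L ℕ.+ D) j)

lemma1p7 : (n : ℕ) (F : List (Subset n)) → Unique F → (x : ℕ) →
    ℕ→ℚ x ≤ lubell F →
    ℕ→ℚ (length F) ≤ ℕ→ℚ (Σnk n x) + (lubell F - ℕ→ℚ x) * ℕ→ℚ (n C ⌈ n ℕ.+ x /2⌉)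
lemma1p7 n F u x _ = begin
  ℕ→ℚ (length F)                       ≡⟨ solve 2 (λ l y → l := l :+ y :- y) refl (ℕ→ℚ (length F)) xM ⟩
  ℕ→ℚ (length F) + xM - xM             ≤⟨ ℚP.+-monoˡ-≤ (- xM) (ℚP.≤-trans (ℚP.+-monoʳ-≤ (ℕ→ℚ (length F)) xM≤DM)
                                                                      (window-inequality n x F u)) ⟩
  M * lubell F + ℕ→ℚ (Σnk n x) - xM    ≡⟨ solve 4 (λ m λF s x → m :* λF :+ s :- x :* m := s :+ (λF :- x) :* m)
                                            refl M (lubell F) (ℕ→ℚ (Σnk n x)) (ℕ→ℚ x) ⟩
  ℕ→ℚ (Σnk n x) + (lubell F - ℕ→ℚ x) * M ∎
  where
  open ℚP.≤-Reasoning
  M = ℕ→ℚ (peak n x)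
  xM = ℕ→ℚ x * M
  -- the window has x levels unless M = 0
  xM≤DM : xM ≤ ℕ→ℚ (width n x) * M
  xM≤DM = subst₂ _≤_ (ℕ→ℚ-* x (peak n x)) (ℕ→ℚ-* (width n x) (peak n x))
            (ℕ→ℚ-mono-≤ (Window.width-covers (central-window n x)))
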